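{- Let $\mathcal P(z)=a_0z^m+a_1z^{m-1}+\cdots+a_m$ be a polynomial of degree $m$ with complex coefficients, and set $a_j:=0$ for $j<0$ or $j>m$. Let $s\in\mathbb N$ and let $p$ be a prime with $(p-1)s\le m$. Then $\Phi_p(z^s)=1+z^s+z^{2s}+\cdots+z^{(p-1)s}$ divides $\mathcal P(z)$ if and only if $$\sum_{j\equiv h\ (\mathrm{mod}\ ps)}a_j=\sum_{j\equiv h-s\ (\mathrm{mod}\ ps)}a_j$$ for every $h\in\{0,1,\ldots,ps-1\}$. When $p=2$, this condition needs to be satisfied only for every $h\in\{0,1,\ldots,s-1\}$.
   Context: $\Phi_p(z)=1+z+\cdots+z^{p-1}$ is the $p$th cyclotomic polynomial. -}

module Defs where

open import Level using (Level)
open import Algebra.Bundles using (CommutativeRing)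
open import Data.Nat using (ℕ; zero; suc; ∣_-_∣) renaming (_+_ to _+ℕ_; _*_ to _*ℕ_)
open import Data.Nat.Divisibility using (_∣?_)
open import Data.Fin using (Fin; toℕ)
open import Data.Fin.Base using () renaming (zero to fzero)
open import Data.List using (List; []; _∷_; _++_; replicate; map; foldr; upTo; reverse)
open import Data.List using () renaming (tabulate to ltabulate)
open import Data.Bool using (if_then_else_)
open import Data.Product using (∃)
open import Relation.Nullary using (does)

-- Univariate polynomials over a commutative ring R, represented by their
-- coefficient lists, lowest degree first:  [c₀, c₁, …] ↦ c₀ + c₁ z + ⋯
module Poly {c ℓ} (R : CommutativeRing c ℓ) where
  open CommutativeRing R

  Pol : Set c
  Pol = List Carrier

  coeff : Pol → ℕ → Carrier
  coeff []       _       = 0#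
  coeff (x ∷ _)  zero    = x
  coeff (_ ∷ xs) (suc n) = coeff xs n

  _+P_ : Pol → Pol → Pol
  []       +P q        = q
  (x ∷ p)  +P []       = x ∷ p
  (x ∷ p)  +P (y ∷ q)  = (x + y) ∷ (p +P q)

  scale : Carrier → Pol → Pol
  scale a = map (a *_)

  _*P_ : Pol → Pol → Pol
  p *P q = foldr (λ a r → scale a q +P (0# ∷ r)) [] p

  _≈P_ : Pol → Pol → Set ℓ
  p ≈P q = ∀ n → coeff p n ≈ coeff q n

  _∣P_ : Pol → Pol → Set (c Level.⊔ ℓ)
  d ∣P p = ∃ λ q → p ≈P (d *P q)

  X^ : ℕ → Pol
  X^ k = replicate k 0# ++ (1# ∷ [])

  sumP : List Pol → Pol
  sumP = foldr _+P_ []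

  Φ[_]∘z^ : ℕ → ℕ → Pol
  Φ[ p ]∘z^ s = sumP (map (λ k → X^ (k *ℕ s)) (upTo p))

  -- 𝒫(z) = a₀ z^m + a₁ z^{m-1} + ⋯ + a_m, given a : Fin (m+1) → R
  polyOf : (m : ℕ) → (Fin (suc m) → Carrier) → Pol
  polyOf m a = reverse (ltabulate a)

  -- Σ_{0 ≤ j ≤ m, j + t ≡ h (mod n)} a_j   (a_j := 0 outside 0..m)
  -- Congruence x ≡ y (mod n) is rendered as n ∣ |x - y|.
  congSum : (m : ℕ) → (Fin (suc m) → Carrier) → (n t h : ℕ) → Carrier
  congSum m a n t h =
    foldr _+_ 0#
      (ltabulate (λ j → if does (n ∣? ∣ (toℕ j +ℕ t) - h ∣) then a j else 0#))

{-# OPTIONS --safe #-}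
module Submission where

open import Defs
open import Algebra.Bundles using (CommutativeRing)
open import Data.Nat using (ℕ; suc; _*_; _∸_; _≤_; _<_)
open import Data.Nat.Primality using (Prime)
open import Data.Fin using (Fin)
open import Data.Fin.Base using () renaming (zero to fzero)
open import Data.Product using (_×_)
open import Function.Bundles using (_⇔_)
open import Relation.Nullary using (¬_)
open import Relation.Binary.PropositionalEquality using (_≡_)

open import Data.Nat
  using (zero; _+_; _%_; _/_; NonZero; z≤n; s≤s; z<s; ∣_-_∣; >-nonZero; >-nonZero⁻¹)
import Data.Nat.Properties as ℕ
open import Data.Nat.DivMod using (m≡m%n+[m/n]*n; m%n<n)
open import Data.Nat.Divisibility
  using (_∣_; _∣?_; _∣0; ∣-refl; ∣m+n∣m⇒∣n; ∣m∣n⇒∣m+n; ∣⇒≤; m∣m*n; n∣m*n)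
open import Data.Nat.Induction using (<-rec)
open import Data.Nat.Primality using (prime⇒nonZero)
open import Data.Nat.Tactic.RingSolver using (solve-∀)
open import Data.Fin using (toℕ) renaming (suc to fsuc)
open import Data.List using ([]; _∷_; _++_; foldr; map; length; reverse; applyUpTo; upTo)
open import Data.List using () renaming (tabulate to ltabulate)
open import Data.List.Properties using (length-tabulate; length-reverse; unfold-reverse)
open import Data.Bool using (if_then_else_)
open import Data.Product using (_,_; ∃-syntax)
open import Data.Sum using (_⊎_; inj₁; inj₂)
import Data.Sum as Sum
open import Function using (_∘_)
open import Function.Bundles using (mk⇔; Equivalence)
open import Relation.Nullary using (Dec; yes; no; does; contradiction)
open import Relation.Nullary.Decidable using (map′)
open import Relation.Binary.PropositionalEquality
  using (refl; sym; trans; cong; cong₂; subst; subst₂)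

-- Write N = p s and read coefficients lowest degree first. Φ_p(z^s) has constant term 1, so
-- every coefficient sequence c has a unique power-series quotient by it, namely
-- (1 - z^s) c / (1 - z^N): its k-th coefficient is the sum of the c_j with j ≤ k, j ≡ k minus
-- the sum of the c_j with j ≤ k - s, j ≡ k - s (mod N). Hence Φ_p(z^s) divides 𝒫 iff this
-- quotient is eventually 0. The coefficient of z^j in 𝒫 is a_{m-j}, so for k ≥ m + s both
-- sums are complete and the k-th coefficient is Σ_{j ≡ h-s} a_j - Σ_{j ≡ h} a_j, where
-- k + h ≡ m + s (mod N); as k runs, h runs through all residues. For p = 2, replacing h by
-- h + s swaps the two sums, so h < s suffices.

module Congruence where

  infix 4 _≡_mod_ _≡?_mod_

  -- A record rather than a synonym so that x and y can be inferred; the decision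
  -- procedure reduces to N ∣? ∣ x - y ∣, the guard used by congSum.
  record _≡_mod_ (x y N : ℕ) : Set where
    constructor divides-∣-∣
    field ∣-∣-divisible : N ∣ ∣ x - y ∣

  open _≡_mod_

  _≡?_mod_ : ∀ x y N → Dec (x ≡ y mod N)
  x ≡? y mod N = map′ divides-∣-∣ ∣-∣-divisible (N ∣? ∣ x - y ∣)

  private
    variable
      N x y z u v : ℕ

  ∣-∣-split : ∀ x y → x + ∣ x - y ∣ ≡ y ⊎ y + ∣ x - y ∣ ≡ x
  ∣-∣-split zero    y       = inj₁ refl
  ∣-∣-split (suc x) zero    = inj₂ refl
  ∣-∣-split (suc x) (suc y) = Sum.map (cong suc) (cong suc) (∣-∣-split x y)

  ∣m∣n⇒∣∣m-n∣ : N ∣ x → N ∣ y → N ∣ ∣ x - y ∣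
  ∣m∣n⇒∣∣m-n∣ {N} {x} {y} N∣x N∣y with ∣-∣-split x y
  ... | inj₁ eq = ∣m+n∣m⇒∣n (subst (N ∣_) (sym eq) N∣y) N∣x
  ... | inj₂ eq = ∣m+n∣m⇒∣n (subst (N ∣_) (sym eq) N∣x) N∣y

  ∣m∣∣m-n∣⇒∣n : N ∣ x → N ∣ ∣ x - y ∣ → N ∣ y
  ∣m∣∣m-n∣⇒∣n {N} {x} {y} N∣x N∣d with ∣-∣-split x y
  ... | inj₁ eq = subst (N ∣_) eq (∣m∣n⇒∣m+n N∣x N∣d)
  ... | inj₂ eq = ∣m+n∣m⇒∣n (subst (N ∣_) (trans (sym eq) (ℕ.+-comm y _)) N∣x) N∣d

  ≡mod-refl : x ≡ x mod N
  ≡mod-refl {x} {N} = divides-∣-∣ (subst (N ∣_) (sym (ℕ.∣n-n∣≡0 x)) (N ∣0))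

  ≡mod-sym : x ≡ y mod N → y ≡ x mod N
  ≡mod-sym {x} {y} {N} (divides-∣-∣ d) = divides-∣-∣ (subst (N ∣_) (ℕ.∣-∣-comm x y) d)

  ≡mod-trans : x ≡ y mod N → y ≡ z mod N → x ≡ z mod N
  ≡mod-trans {x} {y} {N} {z} (divides-∣-∣ d) (divides-∣-∣ e) = divides-∣-∣ (go x y z d e)
    where
    go : ∀ x y z → N ∣ ∣ x - y ∣ → N ∣ ∣ y - z ∣ → N ∣ ∣ x - z ∣
    go zero    y       z       = ∣m∣∣m-n∣⇒∣n
    go (suc x) zero    z       = ∣m∣n⇒∣∣m-n∣
    go (suc x) (suc y) zero    = λ d e → ∣m∣∣m-n∣⇒∣n e (subst (N ∣_) (ℕ.∣-∣-comm x y) d)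
    go (suc x) (suc y) (suc z) = go x y z

  ≡mod-respʳ : y ≡ z mod N → x ≡ y mod N ⇔ x ≡ z mod N
  ≡mod-respʳ y≡z =
    mk⇔ (λ x≡y → ≡mod-trans x≡y y≡z) (λ x≡z → ≡mod-trans x≡z (≡mod-sym y≡z))

  ≡mod-resp-≡ : x ≡ u → y ≡ v → x ≡ y mod N → u ≡ v mod N
  ≡mod-resp-≡ refl refl x≡y = x≡y

  ∣⇒≡mod0 : N ∣ x → x ≡ 0 mod N
  ∣⇒≡mod0 {N} {x} = divides-∣-∣ ∘ subst (N ∣_) (sym (ℕ.∣-∣-identityʳ x))

  +-cancelˡ-≡mod : ∀ z → z + x ≡ z + y mod N → x ≡ y mod N
  +-cancelˡ-≡mod {x} {y} {N} z (divides-∣-∣ d) =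
    divides-∣-∣ (subst (N ∣_) (ℕ.∣m+n-m+o∣≡∣n-o∣ z x y) d)

  +-congˡ-≡mod : ∀ z → x ≡ y mod N → z + x ≡ z + y mod N
  +-congˡ-≡mod {x} {y} {N} z (divides-∣-∣ d) =
    divides-∣-∣ (subst (N ∣_) (sym (ℕ.∣m+n-m+o∣≡∣n-o∣ z x y)) d)

  +-cancelʳ-≡mod : ∀ z → x + z ≡ y + z mod N → x ≡ y mod N
  +-cancelʳ-≡mod {x} {y} z = +-cancelˡ-≡mod z ∘ ≡mod-resp-≡ (ℕ.+-comm x z) (ℕ.+-comm y z)

  +-congʳ-≡mod : ∀ z → x ≡ y mod N → x + z ≡ y + z mod N
  +-congʳ-≡mod {x} {y} z = ≡mod-resp-≡ (ℕ.+-comm z x) (ℕ.+-comm z y) ∘ +-congˡ-≡mod z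

  +-cancel-≡mod : x + y ≡ u + v mod N → x ≡ u mod N ⇔ y ≡ v mod N
  +-cancel-≡mod {x} {y} {u} {v} eq = mk⇔
    (λ x≡u → +-cancelˡ-≡mod u (≡mod-trans (≡mod-sym (+-congʳ-≡mod y x≡u)) eq))
    (λ y≡v → +-cancelʳ-≡mod v (≡mod-trans (≡mod-sym (+-congˡ-≡mod x y≡v)) eq))

  ∣⇒+-≡mod : ∀ {d} x → N ∣ d → d + x ≡ x mod N
  ∣⇒+-≡mod x = +-congʳ-≡mod x ∘ ∣⇒≡mod0

  %-≡mod : ∀ x N .{{_ : NonZero N}} → x % N ≡ x mod N
  %-≡mod x N = ≡mod-resp-≡ (ℕ.+-identityʳ (x % N)) (sym (m≡m%n+[m/n]*n x N))
    (+-congˡ-≡mod (x % N) (≡mod-sym (∣⇒≡mod0 (n∣m*n (x / N)))))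

  <⇒≢mod : x < y → y < N + x → ¬ (x ≡ y mod N)
  <⇒≢mod {x} {y} {N} x<y y<N+x (divides-∣-∣ x≡y) =
    ℕ.<⇒≱ d<N (∣⇒≤ ⦃ >-nonZero (ℕ.m<n⇒0<n∸m x<y) ⦄ N∣d)
    where
    N∣d : N ∣ y ∸ x
    N∣d = subst (N ∣_) (ℕ.m≤n⇒∣m-n∣≡n∸m (ℕ.<⇒≤ x<y)) x≡y
    d<N : y ∸ x < N
    d<N = ℕ.+-cancelˡ-< x (y ∸ x) N
            (subst₂ _<_ (sym (ℕ.m+[n∸m]≡n (ℕ.<⇒≤ x<y))) (ℕ.+-comm N x) y<N+x)

  +-≡mod-solution : .{{_ : NonZero N}} → ∀ L x y → ∃[ z ] L ≤ z × x + z ≡ y mod N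
  +-≡mod-solution {suc r} L x y =
    k , ℕ.≤-trans (ℕ.m≤n*m L (suc r)) (ℕ.m≤m+n _ _) ,
    ≡mod-resp-≡ (sym (rearrange r L x y)) refl (∣⇒+-≡mod y (m∣m*n (L + x)))
    where
    k = suc r * L + (r * x + y)
    rearrange : ∀ r L x y → x + (suc r * L + (r * x + y)) ≡ suc r * (L + x) + y
    rearrange = solve-∀

open Congruence

module _ {r ℓ} (R : CommutativeRing r ℓ) where
  open CommutativeRing R
    renaming (_+_ to _+R_; _*_ to _*R_; _-_ to _-R_; refl to ≈-refl; sym to ≈-sym; trans to ≈-trans)
    hiding (zero)
  open Poly R
  open import Relation.Binary.Reasoning.Setoid setoid
  open import Algebra.Properties.Group +-group
    using (∙-cancelʳ; //-rightDividesʳ; x∙y⁻¹≈ε⇒x≈y; x≈y⇒x∙y⁻¹≈ε)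
  open import Algebra.Properties.CommutativeSemigroup +-commutativeSemigroup using (interchange)

  guard : {P : Set} → Dec P → Carrier → Carrier
  guard P? x = if does P? then x else 0#

  guard-cong : {P Q : Set} (P? : Dec P) (Q? : Dec Q) (x : Carrier) → P ⇔ Q → guard P? x ≈ guard Q? x
  guard-cong (yes _) (yes _) _ _   = ≈-refl
  guard-cong (yes p) (no ¬q) _ P⇔Q = contradiction (Equivalence.to P⇔Q p) ¬q
  guard-cong (no ¬p) (yes q) _ P⇔Q = contradiction (Equivalence.from P⇔Q q) ¬p
  guard-cong (no _)  (no _)  _ _   = ≈-refl

  guard-yes : {P : Set} (P? : Dec P) {x : Carrier} → P → guard P? x ≈ x
  guard-yes (yes _) _ = ≈-refl
  guard-yes (no ¬p) p = contradiction p ¬p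

  guard-no : {P : Set} (P? : Dec P) {x : Carrier} → ¬ P → guard P? x ≈ 0#
  guard-no (yes p) ¬p = contradiction p ¬p
  guard-no (no _)  _  = ≈-refl

  guard-0 : {P : Set} (P? : Dec P) {x : Carrier} → x ≈ 0# → guard P? x ≈ 0#
  guard-0 (yes _) x≈0 = x≈0
  guard-0 (no _)  _   = ≈-refl

  ∑ : ℕ → (ℕ → Carrier) → Carrier
  ∑ zero    f = 0#
  ∑ (suc n) f = f 0 +R ∑ n (f ∘ suc)

  syntax ∑ n (λ i → x) = ∑[ i < n ] x

  ∑-cong : ∀ n {f g : ℕ → Carrier} → (∀ i → i < n → f i ≈ g i) → ∑ n f ≈ ∑ n g
  ∑-cong zero    _   = ≈-refl
  ∑-cong (suc n) f≈g = +-cong (f≈g 0 z<s) (∑-cong n (λ i i<n → f≈g (suc i) (s≤s i<n)))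

  ∑-zero : ∀ n {f : ℕ → Carrier} → (∀ i → i < n → f i ≈ 0#) → ∑ n f ≈ 0#
  ∑-zero zero    _   = ≈-refl
  ∑-zero (suc n) f≈0 =
    ≈-trans (+-cong (f≈0 0 z<s) (∑-zero n (λ i i<n → f≈0 (suc i) (s≤s i<n)))) (+-identityʳ 0#)

  ∑-init-last : ∀ n (f : ℕ → Carrier) → ∑ (suc n) f ≈ ∑ n f +R f n
  ∑-init-last zero    f = ≈-trans (+-identityʳ _) (≈-sym (+-identityˡ _))
  ∑-init-last (suc n) f = ≈-trans (+-congˡ (∑-init-last n (f ∘ suc))) (≈-sym (+-assoc _ _ _))

  ∑-truncate : ∀ {n k} (f : ℕ → Carrier) →
               n ≤ k → (∀ i → n ≤ i → i < k → f i ≈ 0#) → ∑ k f ≈ ∑ n f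
  ∑-truncate {zero}  {k}     f _         f≈0 = ∑-zero k (λ i → f≈0 i z≤n)
  ∑-truncate {suc n} {suc k} f (s≤s n≤k) f≈0 =
    +-congˡ (∑-truncate (f ∘ suc) n≤k (λ i n≤i i<k → f≈0 (suc i) (s≤s n≤i) (s≤s i<k)))

  ∑-telescope : ∀ n (U : ℕ → Carrier) → ∑[ l < n ] (U l -R U (suc l)) ≈ U 0 -R U n
  ∑-telescope zero    U = ≈-sym (-‿inverseʳ (U 0))
  ∑-telescope (suc n) U =
    ≈-trans (+-congˡ (∑-telescope n (U ∘ suc))) (cancel (U 0) (U 1) (U (suc n)))
    where
    cancel : ∀ x y z → (x -R y) +R (y -R z) ≈ x -R z
    cancel x y z = begin
      (x -R y) +R (y -R z)   ≈⟨ +-assoc x (- y) (y -R z) ⟩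
      x +R (- y +R (y -R z)) ≈⟨ +-congˡ (+-assoc (- y) y (- z)) ⟨
      x +R ((- y +R y) -R z) ≈⟨ +-congˡ (+-congʳ (-‿inverseˡ y)) ⟩
      x +R (0# -R z)         ≈⟨ +-congˡ (+-identityˡ (- z)) ⟩
      x -R z                 ∎

  shift : ℕ → (ℕ → Carrier) → ℕ → Carrier
  shift zero    f n       = f n
  shift (suc k) f zero    = 0#
  shift (suc k) f (suc n) = shift k f n

  shift-cong : ∀ k {f g : ℕ → Carrier} → (∀ i → f i ≈ g i) →
               ∀ n → shift k f n ≈ shift k g n
  shift-cong zero    f≈g n       = f≈g n
  shift-cong (suc k) f≈g zero    = ≈-refl
  shift-cong (suc k) f≈g (suc n) = shift-cong k f≈g n

  shift-cong-below : ∀ k {f g : ℕ → Carrier} n → (∀ i → i < n → f i ≈ g i) →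
                     shift (suc k) f n ≈ shift (suc k) g n
  shift-cong-below k       zero    _   = ≈-refl
  shift-cong-below zero    (suc n) f≈g = f≈g n ℕ.≤-refl
  shift-cong-below (suc k) (suc n) f≈g = shift-cong-below k n (λ i i<n → f≈g i (ℕ.m≤n⇒m≤1+n i<n))

  shift-zero : ∀ k {f : ℕ → Carrier} → (∀ i → f i ≈ 0#) → ∀ n → shift k f n ≈ 0#
  shift-zero zero    f≈0 n       = f≈0 n
  shift-zero (suc k) f≈0 zero    = ≈-refl
  shift-zero (suc k) f≈0 (suc n) = shift-zero k f≈0 n

  shift-on-< : ∀ k (f : ℕ → Carrier) n → n < k → shift k f n ≡ 0#
  shift-on-< (suc k) f zero    _         = refl
  shift-on-< (suc k) f (suc n) (s≤s n<k) = shift-on-< k f n n<k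

  shift-on-+ : ∀ k (f : ℕ → Carrier) n → shift k f (k + n) ≡ f n
  shift-on-+ zero    f n = refl
  shift-on-+ (suc k) f n = shift-on-+ k f n

  shift-shift : ∀ j k (f : ℕ → Carrier) n → shift j (shift k f) n ≡ shift (j + k) f n
  shift-shift zero    k f n       = refl
  shift-shift (suc j) k f zero    = refl
  shift-shift (suc j) k f (suc n) = shift-shift j k f n

  shift-distrib-+ : ∀ k (f g : ℕ → Carrier) n →
                    shift k (λ i → f i +R g i) n ≈ shift k f n +R shift k g n
  shift-distrib-+ zero    f g n       = ≈-refl
  shift-distrib-+ (suc k) f g zero    = ≈-sym (+-identityʳ 0#)
  shift-distrib-+ (suc k) f g (suc n) = shift-distrib-+ k f g n

  shift-distrib-− : ∀ k (f g : ℕ → Carrier) n →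
                    shift k (λ i → f i -R g i) n ≈ shift k f n -R shift k g n
  shift-distrib-− zero    f g n       = ≈-refl
  shift-distrib-− (suc k) f g zero    = ≈-sym (-‿inverseʳ 0#)
  shift-distrib-− (suc k) f g (suc n) = shift-distrib-− k f g n

  mulΦ : ℕ → ℕ → (ℕ → Carrier) → ℕ → Carrier
  mulΦ p s f n = ∑[ l < p ] shift (l * s) f n

  mulΦ-cong : ∀ p s {f g : ℕ → Carrier} → (∀ i → f i ≈ g i) →
              ∀ n → mulΦ p s f n ≈ mulΦ p s g n
  mulΦ-cong p s f≈g n = ∑-cong p (λ l _ → shift-cong (l * s) f≈g n)

  mulΦ-injective : ∀ p s .{{_ : NonZero p}} .{{_ : NonZero s}} {f g : ℕ → Carrier} →
                   (∀ n → mulΦ p s f n ≈ mulΦ p s g n) → ∀ n → f n ≈ g n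
  mulΦ-injective (suc p) (suc s) {f} {g} Φf≈Φg = <-rec (λ n → f n ≈ g n) step
    where
    higher : (ℕ → Carrier) → ℕ → Carrier
    higher h n = ∑[ l < p ] shift (suc s + l * suc s) h n
    -- Φ_p(z^s) has constant term 1, so only the first summand sees the n-th coefficient.
    step : ∀ n → (∀ {i} → i < n → f i ≈ g i) → f n ≈ g n
    step n f≈g-below = ∙-cancelʳ (higher f n) (f n) (g n) (begin
      f n +R higher f n ≈⟨ Φf≈Φg n ⟩
      g n +R higher g n ≈⟨ +-congˡ (∑-cong p λ l _ → shift-cong-below _ n λ _ → f≈g-below) ⟨
      g n +R higher f n ∎)

  coeff-+P : ∀ xs ys n → coeff (xs +P ys) n ≈ coeff xs n +R coeff ys n
  coeff-+P []       ys       n       = ≈-sym (+-identityˡ _)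
  coeff-+P (x ∷ xs) []       n       = ≈-sym (+-identityʳ _)
  coeff-+P (x ∷ xs) (y ∷ ys) zero    = ≈-refl
  coeff-+P (x ∷ xs) (y ∷ ys) (suc n) = coeff-+P xs ys n

  coeff-scale : ∀ x ys n → coeff (scale x ys) n ≈ x *R coeff ys n
  coeff-scale x []       n       = ≈-sym (zeroʳ x)
  coeff-scale x (y ∷ ys) zero    = ≈-refl
  coeff-scale x (y ∷ ys) (suc n) = coeff-scale x ys n

  coeff-0∷ : ∀ xs n → coeff (0# ∷ xs) n ≡ shift 1 (coeff xs) n
  coeff-0∷ xs zero    = refl
  coeff-0∷ xs (suc n) = refl

  coeff-∷-*P : ∀ x xs q n → coeff ((x ∷ xs) *P q) n ≈ x *R coeff q n +R shift 1 (coeff (xs *P q)) n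
  coeff-∷-*P x xs q n = begin
    coeff (scale x q +P (0# ∷ xs *P q)) n
      ≈⟨ coeff-+P (scale x q) _ n ⟩
    coeff (scale x q) n +R coeff (0# ∷ xs *P q) n
      ≈⟨ +-cong (coeff-scale x q n) (reflexive (coeff-0∷ (xs *P q) n)) ⟩
    x *R coeff q n +R shift 1 (coeff (xs *P q)) n
      ∎

  coeff-+P-*P : ∀ xs ys q n → coeff ((xs +P ys) *P q) n ≈ coeff (xs *P q) n +R coeff (ys *P q) n
  coeff-+P-*P []       ys       q n = ≈-sym (+-identityˡ _)
  coeff-+P-*P (x ∷ xs) []       q n = ≈-sym (+-identityʳ _)
  coeff-+P-*P (x ∷ xs) (y ∷ ys) q n = begin
    coeff (((x +R y) ∷ (xs +P ys)) *P q) n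
      ≈⟨ coeff-∷-*P (x +R y) (xs +P ys) q n ⟩
    (x +R y) *R c n +R shift 1 (coeff ((xs +P ys) *P q)) n
      ≈⟨ +-cong (distribʳ (c n) x y)
                (≈-trans (shift-cong 1 (coeff-+P-*P xs ys q) n) (shift-distrib-+ 1 A B n)) ⟩
    (x *R c n +R y *R c n) +R (shift 1 A n +R shift 1 B n)
      ≈⟨ interchange _ _ _ _ ⟩
    (x *R c n +R shift 1 A n) +R (y *R c n +R shift 1 B n)
      ≈⟨ +-cong (coeff-∷-*P x xs q n) (coeff-∷-*P y ys q n) ⟨
    coeff ((x ∷ xs) *P q) n +R coeff ((y ∷ ys) *P q) n
      ∎
    where
    c = coeff q
    A = coeff (xs *P q)
    B = coeff (ys *P q)

  coeff-X^-*P : ∀ k q n → coeff (X^ k *P q) n ≈ shift k (coeff q) n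
  coeff-X^-*P zero    q n = begin
    coeff ((1# ∷ []) *P q) n
      ≈⟨ coeff-∷-*P 1# [] q n ⟩
    1# *R coeff q n +R shift 1 (coeff []) n
      ≈⟨ +-cong (*-identityˡ _) (shift-zero 1 (λ _ → ≈-refl) n) ⟩
    coeff q n +R 0#
      ≈⟨ +-identityʳ _ ⟩
    coeff q n
      ∎
  coeff-X^-*P (suc k) q n = begin
    coeff ((0# ∷ X^ k) *P q) n
      ≈⟨ coeff-∷-*P 0# (X^ k) q n ⟩
    0# *R coeff q n +R shift 1 (coeff (X^ k *P q)) n
      ≈⟨ +-cong (zeroˡ _) (shift-cong 1 (coeff-X^-*P k q) n) ⟩
    0# +R shift 1 (shift k (coeff q)) n
      ≈⟨ +-identityˡ _ ⟩
    shift 1 (shift k (coeff q)) n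
      ≡⟨ shift-shift 1 k (coeff q) n ⟩
    shift (suc k) (coeff q) n
      ∎

  coeff-sumP-*P : ∀ (d : ℕ → Pol) ks q n →
                  coeff (sumP (map d ks) *P q) n ≈ foldr _+R_ 0# (map (λ k → coeff (d k *P q) n) ks)
  coeff-sumP-*P d []       q n = ≈-refl
  coeff-sumP-*P d (k ∷ ks) q n = ≈-trans (coeff-+P-*P (d k) _ q n) (+-congˡ (coeff-sumP-*P d ks q n))

  foldr-map-applyUpTo : ∀ (g : ℕ → Carrier) f n →
                        foldr _+R_ 0# (map g (applyUpTo f n)) ≡ ∑[ i < n ] g (f i)
  foldr-map-applyUpTo g f zero    = refl
  foldr-map-applyUpTo g f (suc n) = cong (g (f 0) +R_) (foldr-map-applyUpTo g (f ∘ suc) n)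

  coeff-Φ-*P : ∀ p s q n → coeff (Φ[ p ]∘z^ s *P q) n ≈ mulΦ p s (coeff q) n
  coeff-Φ-*P p s q n = begin
    coeff (Φ[ p ]∘z^ s *P q) n
      ≈⟨ coeff-sumP-*P (λ k → X^ (k * s)) (upTo p) q n ⟩
    foldr _+R_ 0# (map (λ k → coeff (X^ (k * s) *P q) n) (upTo p))
      ≡⟨ foldr-map-applyUpTo _ (λ l → l) p ⟩
    ∑[ l < p ] coeff (X^ (l * s) *P q) n
      ≈⟨ ∑-cong p (λ l _ → coeff-X^-*P (l * s) q n) ⟩
    mulΦ p s (coeff q) n
      ∎

  coeff-≥length : ∀ xs n → length xs ≤ n → coeff xs n ≡ 0#
  coeff-≥length []       n       _         = refl
  coeff-≥length (x ∷ xs) (suc n) (s≤s le) = coeff-≥length xs n le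

  coeff-tabulate : ∀ L (f : ℕ → Carrier) → (∀ k → L ≤ k → f k ≈ 0#) →
                   ∀ k → coeff (ltabulate {n = L} (f ∘ toℕ)) k ≈ f k
  coeff-tabulate zero    f f≈0 k       = ≈-sym (f≈0 k z≤n)
  coeff-tabulate (suc L) f f≈0 zero    = ≈-refl
  coeff-tabulate (suc L) f f≈0 (suc k) =
    coeff-tabulate L (f ∘ suc) (λ k L≤k → f≈0 (suc k) (s≤s L≤k)) k

  coeff-++ˡ : ∀ xs ys j → j < length xs → coeff (xs ++ ys) j ≡ coeff xs j
  coeff-++ˡ (x ∷ xs) ys zero    _         = refl
  coeff-++ˡ (x ∷ xs) ys (suc j) (s≤s j<n) = coeff-++ˡ xs ys j j<n

  coeff-++ʳ : ∀ xs ys j → coeff (xs ++ ys) (length xs + j) ≡ coeff ys j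
  coeff-++ʳ []       ys j = refl
  coeff-++ʳ (x ∷ xs) ys j = coeff-++ʳ xs ys j

  ∑-coeff-reverse : ∀ xs (g : ℕ → Carrier → Carrier) →
    ∑[ j < length xs ] g j (coeff (reverse xs) j) ≈
    ∑[ i < length xs ] g (length xs ∸ suc i) (coeff xs i)
  ∑-coeff-reverse []       g = ≈-refl
  ∑-coeff-reverse (x ∷ xs) g = begin
    ∑[ j < suc n ] g j (coeff (reverse (x ∷ xs)) j)
      ≈⟨ ∑-init-last n _ ⟩
    ∑[ j < n ] g j (coeff (reverse (x ∷ xs)) j) +R g n (coeff (reverse (x ∷ xs)) n)
      ≈⟨ +-cong (∑-cong n λ j j<n → reflexive (cong (g j) (init j j<n))) (reflexive (cong (g n) last)) ⟩
    ∑[ j < n ] g j (coeff (reverse xs) j) +R g n x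
      ≈⟨ +-congʳ (∑-coeff-reverse xs g) ⟩
    ∑[ i < n ] g (n ∸ suc i) (coeff xs i) +R g n x
      ≈⟨ +-comm _ _ ⟩
    ∑[ i < suc n ] g (suc n ∸ suc i) (coeff (x ∷ xs) i)
      ∎
    where
    n = length xs
    init : ∀ j → j < n → coeff (reverse (x ∷ xs)) j ≡ coeff (reverse xs) j
    init j j<n = trans (cong (λ ys → coeff ys j) (unfold-reverse x xs))
                       (coeff-++ˡ (reverse xs) _ j (subst (j <_) (sym (length-reverse xs)) j<n))
    last : coeff (reverse (x ∷ xs)) n ≡ x
    last = trans (cong₂ coeff (unfold-reverse x xs) (sym (trans (ℕ.+-identityʳ _) (length-reverse xs))))
                 (coeff-++ʳ (reverse xs) _ 0)

  foldr-tabulate : ∀ n (a : Fin n → Carrier) (G : ℕ → Carrier → Carrier) →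
    foldr _+R_ 0# (ltabulate (λ j → G (toℕ j) (a j))) ≡ ∑[ i < n ] G i (coeff (ltabulate a) i)
  foldr-tabulate zero    a G = refl
  foldr-tabulate (suc n) a G = cong (G 0 (a fzero) +R_) (foldr-tabulate n (a ∘ fsuc) (G ∘ suc))

  -- Coefficients of c / (1 - z^N).
  classSum : ℕ → (ℕ → Carrier) → ℕ → Carrier
  classSum N c k = ∑[ j < suc k ] guard (j ≡? k mod N) (c j)

  classSum-rec : ∀ N .{{_ : NonZero N}} c k → classSum N c k ≈ c k +R shift N (classSum N c) k
  classSum-rec N c k = begin
    classSum N c k                   ≈⟨ ∑-init-last k (term k) ⟩
    ∑[ j < k ] term k j +R term k k  ≈⟨ +-comm _ _ ⟩
    term k k +R ∑[ j < k ] term k j  ≈⟨ +-cong (guard-yes (k ≡? k mod N) ≡mod-refl) (earlier k) ⟩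
    c k +R shift N (classSum N c) k  ∎
    where
    term : ℕ → ℕ → Carrier
    term n j = guard (j ≡? n mod N) (c j)
    earlier : ∀ n → ∑[ j < n ] term n j ≈ shift N (classSum N c) n
    earlier n with n ℕ.<? N
    ... | yes n<N = begin
      ∑[ j < n ] term n j       ≈⟨ ∑-zero n before ⟩
      0#                        ≡⟨ shift-on-< N _ n n<N ⟨
      shift N (classSum N c) n  ∎
      where
      before : ∀ j → j < n → term n j ≈ 0#
      before j j<n = guard-no (j ≡? n mod N) (<⇒≢mod j<n (ℕ.<-≤-trans n<N (ℕ.m≤m+n N j)))
    ... | no n≮N with ℕ.m≤n⇒∃[o]m+o≡n (ℕ.≮⇒≥ n≮N)
    ... | d , refl = begin
      ∑[ j < N + d ] term (N + d) j   ≈⟨ ∑-truncate (term (N + d)) (ℕ.+-monoˡ-≤ d (>-nonZero⁻¹ N)) between ⟩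
      ∑[ j < suc d ] term (N + d) j   ≈⟨ ∑-cong (suc d) (λ j _ → same-class j) ⟩
      classSum N c d                  ≡⟨ shift-on-+ N _ d ⟨
      shift N (classSum N c) (N + d)  ∎
      where
      between : ∀ j → suc d ≤ j → j < N + d → term (N + d) j ≈ 0#
      between j d<j j<N+d = guard-no (j ≡? N + d mod N) (<⇒≢mod j<N+d (ℕ.+-monoʳ-< N d<j))
      same-class : ∀ j → term (N + d) j ≈ term d j
      same-class j = guard-cong (j ≡? N + d mod N) (j ≡? d mod N) (c j) (≡mod-respʳ (∣⇒+-≡mod d ∣-refl))

  -- Coefficients of c / Φ_p(z^s) = (1 - z^s) c / (1 - z^N), where N = p s.
  quotientSeries : ℕ → ℕ → (ℕ → Carrier) → ℕ → Carrier
  quotientSeries N s c k = classSum N c k -R shift s (classSum N c) k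

  mulΦ-quotientSeries : ∀ p s .{{_ : NonZero (p * s)}} c n →
                        mulΦ p s (quotientSeries (p * s) s c) n ≈ c n
  mulΦ-quotientSeries p s c n = begin
    mulΦ p s (quotientSeries N s c) n    ≈⟨ ∑-cong p (λ l _ → shift-quotientSeries l) ⟩
    ∑[ l < p ] (U l -R U (suc l))        ≈⟨ ∑-telescope p U ⟩
    S n -R shift N S n                   ≈⟨ +-congʳ (classSum-rec N c n) ⟩
    (c n +R shift N S n) -R shift N S n  ≈⟨ //-rightDividesʳ (shift N S n) (c n) ⟩
    c n                                  ∎
    where
    N = p * s
    S = classSum N c
    U : ℕ → Carrier
    U l = shift (l * s) S n
    shift-quotientSeries : ∀ l → shift (l * s) (quotientSeries N s c) n ≈ U l -R U (suc l)
    shift-quotientSeries l = begin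
      shift (l * s) (quotientSeries N s c) n  ≈⟨ shift-distrib-− (l * s) S (shift s S) n ⟩
      U l -R shift (l * s) (shift s S) n      ≡⟨ cong (U l -R_) (shift-shift (l * s) s S n) ⟩
      U l -R shift (l * s + s) S n            ≡⟨ cong (λ j → U l -R shift j S n) (ℕ.+-comm (l * s) s) ⟩
      U l -R U (suc l)                        ∎

  Φ∘z^-∣P⇔quotientSeries-vanishes : ∀ p s .{{_ : NonZero p}} .{{_ : NonZero s}} P →
    (Φ[ p ]∘z^ s ∣P P) ⇔ (∃[ L ] ∀ k → L ≤ k → quotientSeries (p * s) s (coeff P) k ≈ 0#)
  Φ∘z^-∣P⇔quotientSeries-vanishes p s P = mk⇔ to from
    where
    instance
      _ = ℕ.m*n≢0 p s
    Q = quotientSeries (p * s) s (coeff P)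
    to : Φ[ p ]∘z^ s ∣P P → ∃[ L ] ∀ k → L ≤ k → Q k ≈ 0#
    to (q , P≈Φq) = length q , λ k L≤k → ≈-trans (Q≈q k) (reflexive (coeff-≥length q k L≤k))
      where
      Q≈q : ∀ k → Q k ≈ coeff q k
      Q≈q = mulΦ-injective p s λ n → begin
        mulΦ p s Q n                ≈⟨ mulΦ-quotientSeries p s (coeff P) n ⟩
        coeff P n                   ≈⟨ P≈Φq n ⟩
        coeff (Φ[ p ]∘z^ s *P q) n  ≈⟨ coeff-Φ-*P p s q n ⟩
        mulΦ p s (coeff q) n        ∎
    from : ∃[ L ] (∀ k → L ≤ k → Q k ≈ 0#) → Φ[ p ]∘z^ s ∣P P
    from (L , Q≈0) = q , λ n → begin
      coeff P n                   ≈⟨ mulΦ-quotientSeries p s (coeff P) n ⟨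
      mulΦ p s Q n                ≈⟨ mulΦ-cong p s (λ k → ≈-sym (coeff-tabulate L Q Q≈0 k)) n ⟩
      mulΦ p s (coeff q) n        ≈⟨ coeff-Φ-*P p s q n ⟨
      coeff (Φ[ p ]∘z^ s *P q) n  ∎
      where
      q = ltabulate {n = L} (Q ∘ toℕ)

  module _ (m : ℕ) (a : Fin (suc m) → Carrier) where

    ã 𝒫 : ℕ → Carrier
    ã = coeff (ltabulate a)
    𝒫 = coeff (polyOf m a)

    congSum-∑ : ∀ N t h → congSum m a N t h ≡ ∑[ i < suc m ] guard (i + t ≡? h mod N) (ã i)
    congSum-∑ N t h = foldr-tabulate (suc m) a (λ i → guard (i + t ≡? h mod N))

    congSum-cong : ∀ N t h t′ h′ → t + h′ ≡ t′ + h mod N →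
                   congSum m a N t h ≈ congSum m a N t′ h′
    congSum-cong N t h t′ h′ t+h′≡t′+h = begin
      congSum m a N t h                                  ≡⟨ congSum-∑ N t h ⟩
      ∑[ i < suc m ] guard (i + t ≡? h mod N) (ã i)      ≈⟨ ∑-cong (suc m) (λ i _ → same-class i) ⟩
      ∑[ i < suc m ] guard (i + t′ ≡? h′ mod N) (ã i)    ≡⟨ congSum-∑ N t′ h′ ⟨
      congSum m a N t′ h′                                ∎
      where
      rearrange : ∀ i t h → i + (t + h) ≡ h + (i + t)
      rearrange = solve-∀
      same-class : ∀ i → guard (i + t ≡? h mod N) (ã i) ≈ guard (i + t′ ≡? h′ mod N) (ã i)
      same-class i = guard-cong (i + t ≡? h mod N) (i + t′ ≡? h′ mod N) (ã i)
        (mk⇔ (≡mod-sym ∘ Equivalence.to iff) (Equivalence.from iff ∘ ≡mod-sym))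
        where
        iff : i + t ≡ h mod N ⇔ h′ ≡ i + t′ mod N
        iff = +-cancel-≡mod (≡mod-resp-≡ (sym (ℕ.+-assoc i t h′)) (rearrange i t′ h)
                                         (+-congˡ-≡mod i t+h′≡t′+h))

    classSum-polyOf : ∀ N t h K → m ≤ K → K + h ≡ m + t mod N → classSum N 𝒫 K ≈ congSum m a N t h
    classSum-polyOf N t h K m≤K K+h≡m+t = begin
      ∑[ j < suc K ] G j (𝒫 j)                       ≈⟨ ∑-truncate (λ j → G j (𝒫 j)) (s≤s m≤K) beyond ⟩
      ∑[ j < suc m ] G j (𝒫 j)                       ≈⟨ reversed ⟩
      ∑[ i < suc m ] G (m ∸ i) (ã i)                 ≈⟨ ∑-cong (suc m) (λ i i≤m → same-class i (ℕ.≤-pred i≤m)) ⟩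
      ∑[ i < suc m ] guard (i + t ≡? h mod N) (ã i)  ≡⟨ congSum-∑ N t h ⟨
      congSum m a N t h                              ∎
      where
      G : ℕ → Carrier → Carrier
      G j = guard (j ≡? K mod N)
      length-polyOf : length (polyOf m a) ≡ suc m
      length-polyOf = trans (length-reverse (ltabulate a)) (length-tabulate a)
      beyond : ∀ j → suc m ≤ j → j < suc K → G j (𝒫 j) ≈ 0#
      beyond j m<j _ = guard-0 (j ≡? K mod N)
        (reflexive (coeff-≥length (polyOf m a) j (subst (_≤ j) (sym length-polyOf) m<j)))
      reversed : ∑[ j < suc m ] G j (𝒫 j) ≈ ∑[ i < suc m ] G (m ∸ i) (ã i)
      reversed = subst (λ n → ∑[ j < n ] G j (𝒫 j) ≈ ∑[ i < n ] G (n ∸ suc i) (ã i))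
                       (length-tabulate a) (∑-coeff-reverse (ltabulate a) G)
      same-class : ∀ i → i ≤ m → G (m ∸ i) (ã i) ≈ guard (i + t ≡? h mod N) (ã i)
      same-class i i≤m = guard-cong (m ∸ i ≡? K mod N) (i + t ≡? h mod N) (ã i)
        (+-cancel-≡mod (≡mod-resp-≡ m+t≡m∸i+[i+t] refl (≡mod-sym K+h≡m+t)))
        where
        m+t≡m∸i+[i+t] : m + t ≡ m ∸ i + (i + t)
        m+t≡m∸i+[i+t] = sym (trans (sym (ℕ.+-assoc (m ∸ i) i t)) (cong (_+ t) (ℕ.m∸n+n≡m i≤m)))

    quotientSeries-polyOf : ∀ N s h k → m + s ≤ k → k + h ≡ m + s mod N →
      quotientSeries N s 𝒫 k ≈ congSum m a N s h -R congSum m a N 0 h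
    quotientSeries-polyOf N s h k m+s≤k k+h≡m+s with ℕ.m≤n⇒∃[o]m+o≡n (ℕ.m+n≤o⇒n≤o m m+s≤k)
    ... | d , refl = +-cong (classSum-polyOf N s h (s + d) (ℕ.m+n≤o⇒m≤o m m+s≤k) k+h≡m+s) (-‿cong (begin
      shift s (classSum N 𝒫) (s + d)  ≡⟨ shift-on-+ s _ d ⟩
      classSum N 𝒫 d                  ≈⟨ classSum-polyOf N 0 h d m≤d d+h≡m+0 ⟩
      congSum m a N 0 h               ∎))
      where
      m≤d : m ≤ d
      m≤d = ℕ.+-cancelʳ-≤ s m d (subst (m + s ≤_) (ℕ.+-comm s d) m+s≤k)
      rearrange : ∀ m s → m + s ≡ s + (m + 0)
      rearrange = solve-∀
      d+h≡m+0 : d + h ≡ m + 0 mod N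
      d+h≡m+0 = +-cancelˡ-≡mod s (≡mod-resp-≡ (ℕ.+-assoc s d h) (rearrange m s) k+h≡m+s)

    Balanced : ℕ → ℕ → ℕ → Set ℓ
    Balanced N s h = congSum m a N 0 h ≈ congSum m a N s h

    Φ∘z^-∣P⇔balanced : ∀ p s .{{_ : NonZero p}} .{{_ : NonZero s}} →
                       (Φ[ p ]∘z^ s ∣P polyOf m a) ⇔ (∀ h → h < p * s → Balanced (p * s) s h)
    Φ∘z^-∣P⇔balanced p s = mk⇔
      (λ Φ∣P h _ → balanced (Equivalence.to vanishing Φ∣P) h)
      (λ H → Equivalence.from vanishing (m + s , vanishes (balanced-mod H)))
      where
      instance
        _ = ℕ.m*n≢0 p s
      N = p * s
      Q = quotientSeries N s 𝒫
      vanishing = Φ∘z^-∣P⇔quotientSeries-vanishes p s (polyOf m a)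
      balanced : (∃[ L ] ∀ k → L ≤ k → Q k ≈ 0#) → ∀ h → Balanced N s h
      balanced (L , Q≈0) h with +-≡mod-solution {N} (L + (m + s)) h (m + s)
      ... | k , L+m+s≤k , h+k≡m+s = ≈-sym (x∙y⁻¹≈ε⇒x≈y _ _ (begin
        congSum m a N s h -R congSum m a N 0 h  ≈⟨ quotientSeries-polyOf N s h k m+s≤k k+h≡m+s ⟨
        Q k                                     ≈⟨ Q≈0 k (ℕ.m+n≤o⇒m≤o L L+m+s≤k) ⟩
        0#                                      ∎))
        where
        m+s≤k = ℕ.m+n≤o⇒n≤o L L+m+s≤k
        k+h≡m+s = ≡mod-resp-≡ (ℕ.+-comm h k) refl h+k≡m+s
      balanced-mod : (∀ h → h < N → Balanced N s h) → ∀ h → Balanced N s h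
      balanced-mod H h = begin
        congSum m a N 0 h        ≈⟨ congSum-cong N 0 h 0 (h % N) (%-≡mod h N) ⟩
        congSum m a N 0 (h % N)  ≈⟨ H (h % N) (m%n<n h N) ⟩
        congSum m a N s (h % N)  ≈⟨ congSum-cong N s (h % N) s h (+-congˡ-≡mod s (≡mod-sym (%-≡mod h N))) ⟩
        congSum m a N s h        ∎
      vanishes : (∀ h → Balanced N s h) → ∀ k → m + s ≤ k → Q k ≈ 0#
      vanishes H k m+s≤k with +-≡mod-solution {N} 0 k (m + s)
      ... | h , _ , k+h≡m+s = begin
        Q k                                     ≈⟨ quotientSeries-polyOf N s h k m+s≤k k+h≡m+s ⟩
        congSum m a N s h -R congSum m a N 0 h  ≈⟨ x≈y⇒x∙y⁻¹≈ε (≈-sym (H h)) ⟩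
        0#                                      ∎

    Φ₂∘z^-∣P⇔balanced : ∀ s .{{_ : NonZero s}} →
                        (Φ[ 2 ]∘z^ s ∣P polyOf m a) ⇔ (∀ h → h < s → Balanced (2 * s) s h)
    Φ₂∘z^-∣P⇔balanced s = mk⇔
      (λ Φ∣P h h<s → Equivalence.to (Φ∘z^-∣P⇔balanced 2 s) Φ∣P h (ℕ.<-≤-trans h<s (ℕ.m≤m+n s _)))
      (λ H → Equivalence.from (Φ∘z^-∣P⇔balanced 2 s) (extend H))
      where
      N = 2 * s
      extend : (∀ h → h < s → Balanced N s h) → ∀ h → h < N → Balanced N s h
      extend H h h<N with h ℕ.<? s
      ... | yes h<s = H h h<s
      ... | no h≮s with ℕ.m≤n⇒∃[o]m+o≡n (ℕ.≮⇒≥ h≮s)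
      ... | h′ , refl = begin
        congSum m a N 0 (s + h′)  ≈⟨ congSum-cong N 0 (s + h′) s h′ h′≡s+[s+h′] ⟩
        congSum m a N s h′        ≈⟨ H h′ h′<s ⟨
        congSum m a N 0 h′        ≈⟨ congSum-cong N 0 h′ s (s + h′) ≡mod-refl ⟩
        congSum m a N s (s + h′)  ∎
        where
        h′<s : h′ < s
        h′<s = subst (h′ <_) (ℕ.+-identityʳ s) (ℕ.+-cancelˡ-< s h′ (s + 0) h<N)
        double : ∀ s h → 2 * s + h ≡ s + (s + h)
        double = solve-∀
        h′≡s+[s+h′] : h′ ≡ s + (s + h′) mod N
        h′≡s+[s+h′] = ≡mod-sym (≡mod-resp-≡ (double s h′) refl (∣⇒+-≡mod h′ ∣-refl))

open Poly using (Φ[_]∘z^; _∣P_; polyOf; congSum)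

lemma2p9 : ∀ {c ℓ} (R : CommutativeRing c ℓ) → let open CommutativeRing R renaming (_*_ to _*R_) in
    (m : ℕ) (a : Fin (suc m) → Carrier) → ¬ (a fzero ≈ 0#) →
    (s p : ℕ) → 1 ≤ s → Prime p → (p ∸ 1) * s ≤ m →
      ((_∣P_ R (Φ[_]∘z^ R p s) (polyOf R m a))
         ⇔ (∀ h → h < p * s → congSum R m a (p * s) 0 h ≈ congSum R m a (p * s) s h))
      × (p ≡ 2 →
          ((_∣P_ R (Φ[_]∘z^ R p s) (polyOf R m a))
             ⇔ (∀ h → h < s → congSum R m a (p * s) 0 h ≈ congSum R m a (p * s) s h)))
lemma2p9 R m a _ s p 1≤s p-prime _ =
  Φ∘z^-∣P⇔balanced R m a p s , λ { refl → Φ₂∘z^-∣P⇔balanced R m a s }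
  where
  instance
    _ = prime⇒nonZero p-prime
    _ = >-nonZero 1≤s
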